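{- Let $p$ be a prime and let $V$ be an $\mathbb{F}_p$-vector space of dimension $d\geq 3$ with basis $v_1,\ldots,v_d$, equipped with a non-degenerate skew-symmetric bilinear form $(\cdot,\cdot)\colon V\times V\to\mathbb{F}_p$. Let $N$ be the number of triples $(x,y,z)\in V^3$ such that $(x,y)=(y,z)=0$ and $x,y,z$ are $\mathbb{F}_p$-linearly independent. (1) If $(v_i,v_i)=0$ for all $1\leq i\leq d$, then $N=(p^d-1)(p^{d-1}-p)(p^{d-1}-p^2)$. (2) If $(v_1,v_1)=1$ and $(v_i,v_i)=0$ for all $2\leq i\leq d$, then $p=2$ and $N=(2^{d-1}-1)(2^{d-1}-2)(2^d-4)$.
   Context: A bilinear form is skew-symmetric if $(x,y)=-(y,x)$ for all $x,y$. -}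

module Defs where

open import Data.Nat using (ℕ; _+_; _∸_; NonZero)
open import Data.Nat.DivMod using (_mod_)
open import Data.Fin using (Fin; toℕ)
open import Data.Vec using (Vec; replicate; zipWith; map; _[_]≔_)
open import Data.Product using (Σ; _×_)
open import Data.List using (List; length)
open import Data.List.Membership.Propositional using (_∈_)
open import Data.List.Relation.Unary.Unique.Propositional using (Unique)
open import Relation.Binary.PropositionalEquality using (_≡_)

module _ (p : ℕ) .{{_ : NonZero p}} where

  𝔽 : Set
  𝔽 = Fin p

  0𝔽 : 𝔽
  0𝔽 = 0 mod p

  1𝔽 : 𝔽
  1𝔽 = 1 mod p

  _+𝔽_ : 𝔽 → 𝔽 → 𝔽
  a +𝔽 b = (toℕ a + toℕ b) mod p

  _*𝔽_ : 𝔽 → 𝔽 → 𝔽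
  a *𝔽 b = (toℕ a Data.Nat.* toℕ b) mod p

  -𝔽_ : 𝔽 → 𝔽
  -𝔽 a = (p ∸ toℕ a) mod p

  -- V = 𝔽_p^d, vectors written in coordinates w.r.t. the basis v_1,…,v_d
  Vect : ℕ → Set
  Vect d = Vec 𝔽 d

  0V : (d : ℕ) → Vect d
  0V d = replicate d 0𝔽

  _+V_ : {d : ℕ} → Vect d → Vect d → Vect d
  x +V y = zipWith _+𝔽_ x y

  _·V_ : {d : ℕ} → 𝔽 → Vect d → Vect d
  a ·V x = map (a *𝔽_) x

  basis : (d : ℕ) → Fin d → Vect d
  basis d i = (0V d) [ i ]≔ 1𝔽

  IsBilinear : (d : ℕ) → (Vect d → Vect d → 𝔽) → Set
  IsBilinear d B =
      (∀ x y z → B (x +V y) z ≡ B x z +𝔽 B y z)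
    × (∀ a x z → B (a ·V x) z ≡ a *𝔽 B x z)
    × (∀ x y z → B x (y +V z) ≡ B x y +𝔽 B x z)
    × (∀ a x z → B x (a ·V z) ≡ a *𝔽 B x z)

  IsSkewSymmetric : (d : ℕ) → (Vect d → Vect d → 𝔽) → Set
  IsSkewSymmetric d B = ∀ x y → B x y ≡ -𝔽 (B y x)

  IsNonDegenerate : (d : ℕ) → (Vect d → Vect d → 𝔽) → Set
  IsNonDegenerate d B = ∀ x → (∀ y → B x y ≡ 0𝔽) → x ≡ 0V d

  LinIndep3 : (d : ℕ) → Vect d → Vect d → Vect d → Set
  LinIndep3 d x y z =
    ∀ a b c → ((a ·V x) +V (b ·V y)) +V (c ·V z) ≡ 0V d →
      (a ≡ 0𝔽) × (b ≡ 0𝔽) × (c ≡ 0𝔽)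

  GoodTriple : (d : ℕ) → (Vect d → Vect d → 𝔽) → Vect d × Vect d × Vect d → Set
  GoodTriple d B (x Data.Product., y Data.Product., z) =
    (B x y ≡ 0𝔽) × (B y z ≡ 0𝔽) × LinIndep3 d x y z

HasCard : {A : Set} → (A → Set) → ℕ → Set
HasCard {A} P N =
  Σ (List A) λ L → Unique L × (∀ a → (a ∈ L → P a) × (P a → a ∈ L)) × (length L ≡ N)

module Submission where

-- Group the triples by their middle vector y ≠ 0.  By non-degeneracy y^⊥ is a
-- hyperplane with p^n elements, and (x, y, z) is admissible iff
-- x ∈ y^⊥ ∖ ⟨y⟩ and z ∈ y^⊥ ∖ ⟨x, y⟩.  Whether ⟨y⟩ and ⟨x, y⟩ lie inside y^⊥
-- depends only on the norm q(y) = (y, y): if q(y) = 0 they have p and p²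
-- elements there, otherwise 1 and p.  Hence N = z₀ (p^n - p)(p^n - p²) +
-- z₁ (p^n - 1)(p^n - p), with z₀, z₁ the numbers of non-zero isotropic and of
-- anisotropic vectors.  Skew-symmetry makes q additive, so in case (1) q
-- vanishes on all of V (z₁ = 0); in case (2) q(v₁) = 1 = -1 forces p = 2,
-- where q is a non-zero linear functional (z₀ = p^n - 1, z₁ = p^d - p^n).

open import Defs
open import Data.Nat using (ℕ; _≤_; _∸_; _*_; _^_; NonZero)
open import Data.Nat.Primality using (Prime)
open import Data.Fin using (Fin; toℕ)
open import Data.Product using (_×_)
open import Relation.Binary.PropositionalEquality using (_≡_; _≢_)

open import Data.Nat using (suc; _+_; z≤n; s≤s)
open import Data.Nat.Properties using (*-assoc; *-identityʳ; +-identityʳ; m+n∸m≡n; ^-monoʳ-≤; m≤n⇒∃[o]m+o≡n)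
open import Data.Nat.Solver using (module +-*-Solver)
open import Data.Fin using (zero)
open import Data.Product using (_,_)
open import Data.Product.Properties using (≡-dec)
open import Relation.Binary.PropositionalEquality using (refl; sym; trans; cong; subst)

module Counting where

  open import Data.Nat using (ℕ; _+_; _*_; _∸_; _≤_; z≤n; s≤s)
  open import Data.Nat.Properties using (≤-antisym; ≤-trans; +-comm; m+n∸m≡n)
  open import Data.List using (List; []; _∷_; length; map; _++_; filter)
  open import Data.List.Properties using (length-map; length-++; filter-notAll)
  open import Data.List.Membership.Propositional using (_∈_; find; lose)
  open import Data.List.Membership.Propositional.Properties
    using (∈-map⁺; ∈-map⁻; ∈-++⁺ˡ; ∈-++⁺ʳ; ∈-++⁻; ∈-filter⁺; ∈-filter⁻)
  open import Data.List.Relation.Unary.Unique.Propositional using (Unique)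
  open import Data.List.Relation.Unary.Unique.Propositional.Properties
    using (++⁺; filter⁺; Unique[x∷xs]⇒x∉xs)
  open import Data.List.Relation.Unary.AllPairs using ([]; _∷_)
  open import Data.List.Relation.Unary.All using (All; []; _∷_)
  open import Data.List.Relation.Unary.Any using (Any; here; there; any?)
  open import Data.Product using (Σ; _×_; _,_; proj₁; proj₂)
  open import Data.Sum using (_⊎_; inj₁; inj₂) renaming (map to ⊎-map)
  open import Data.Empty using (⊥; ⊥-elim)
  open import Relation.Nullary using (¬_; Dec; yes; no)
  open import Relation.Nullary.Decidable using (¬?)
  open import Relation.Binary.Definitions using (DecidableEquality)
  open import Relation.Binary.PropositionalEquality

  private variable
    A B : Set

  -- A duplicate-free list all of whose members lie in ys is at most as long
  -- as ys: remove the head of xs from ys and recurse.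
  unique-⊆⇒length-≤ : DecidableEquality A → (xs ys : List A) → Unique xs →
                       (∀ a → a ∈ xs → a ∈ ys) → length xs ≤ length ys
  unique-⊆⇒length-≤ _≟_ [] ys _ _ = z≤n
  unique-⊆⇒length-≤ {A} _≟_ (x ∷ xs) ys (x∉xs ∷ u) xs⊆ys =
    ≤-trans (s≤s (unique-⊆⇒length-≤ _≟_ xs ys-x u xs⊆ys-x))
            (filter-notAll (λ a → ¬? (a ≟ x)) ys (¬¬-at (xs⊆ys x (here refl))))
    where
    ys-x : List A
    ys-x = filter (λ a → ¬? (a ≟ x)) ys
    ¬¬-at : ∀ {zs} → x ∈ zs → Any (λ a → ¬ ¬ (a ≡ x)) zs
    ¬¬-at (here e) = here (λ k → k (sym e))
    ¬¬-at (there m) = there (¬¬-at m)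
    ≢-head : ∀ {a zs} → All (x ≢_) zs → a ∈ zs → ¬ (a ≡ x)
    ≢-head (x≢ ∷ _) (here refl) e = x≢ (sym e)
    ≢-head (_ ∷ x≢s) (there m) e = ≢-head x≢s m e
    xs⊆ys-x : ∀ a → a ∈ xs → a ∈ ys-x
    xs⊆ys-x a m = ∈-filter⁺ (λ a → ¬? (a ≟ x)) (xs⊆ys a (there m)) (≢-head x∉xs m)

  card-unique : DecidableEquality A → {P : A → Set} {m n : ℕ} →
                HasCard P m → HasCard P n → m ≡ n
  card-unique _≟_ (L , uL , hL , refl) (M , uM , hM , refl) =
    ≤-antisym (unique-⊆⇒length-≤ _≟_ L M uL (λ a m → proj₂ (hM a) (proj₁ (hL a) m)))
              (unique-⊆⇒length-≤ _≟_ M L uM (λ a m → proj₂ (hL a) (proj₁ (hM a) m)))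

  card-cong : {P Q : A → Set} {n : ℕ} → (∀ a → P a → Q a) → (∀ a → Q a → P a) →
              HasCard P n → HasCard Q n
  card-cong P⇒Q Q⇒P (L , u , h , e) =
    L , u , (λ a → (λ m → P⇒Q a (proj₁ (h a) m)) , (λ q → proj₂ (h a) (Q⇒P a q))) , e

  card-singleton : (a₀ : A) → HasCard (λ a → a ≡ a₀) 1
  card-singleton a₀ =
    (a₀ ∷ []) , ([] ∷ []) , (λ a → (λ { (here e) → e }) , (λ { refl → here refl })) , refl

  card-empty : {P : A → Set} → (∀ a → ¬ P a) → HasCard P 0
  card-empty ¬P = [] , [] , (λ a → (λ ()) , (λ pa → ⊥-elim (¬P a pa))) , refl

  search : {P Q : A → Set} {n : ℕ} → HasCard P n → (∀ a → Dec (Q a)) →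
           (Σ A λ a → P a × Q a) ⊎ (∀ a → P a → ¬ Q a)
  search (L , _ , h , _) Q? with any? Q? L
  ... | yes found = let (a , a∈L , qa) = find found in inj₁ (a , proj₁ (h a) a∈L , qa)
  ... | no none = inj₂ (λ a pa qa → none (lose (proj₂ (h a) pa) qa))

  Image : (A → B) → (A → Set) → B → Set
  Image {A} g P b = Σ A λ a → P a × b ≡ g a

  card-image : {P : A → Set} {n : ℕ} (g : A → B) →
               (∀ {a a'} → P a → P a' → g a ≡ g a' → a ≡ a') →
               HasCard P n → HasCard (Image g P) n
  card-image {A = A} {P = P} g inj (L , u , h , e) =
    map g L , map-unique L u (λ a m → proj₁ (h a) m) , members , trans (length-map g L) e
    where
    g-fresh : ∀ {a} (zs : List A) → P a → (∀ z → z ∈ zs → P z) →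
              All (a ≢_) zs → All (g a ≢_) (map g zs)
    g-fresh [] _ _ [] = []
    g-fresh (z ∷ zs) pa pzs (a≢z ∷ a∉zs) =
      (λ e → a≢z (inj pa (pzs z (here refl)) e)) ∷ g-fresh zs pa (λ w m → pzs w (there m)) a∉zs
    map-unique : (zs : List A) → Unique zs → (∀ z → z ∈ zs → P z) → Unique (map g zs)
    map-unique [] _ _ = []
    map-unique (z ∷ zs) (z∉zs ∷ u) pzs =
      g-fresh zs (pzs z (here refl)) (λ w m → pzs w (there m)) z∉zs
        ∷ map-unique zs u (λ w m → pzs w (there m))
    members : ∀ b → (b ∈ map g L → Image g P b) × (Image g P b → b ∈ map g L)
    members b = (λ m → let (a , am , be) = ∈-map⁻ g m in a , proj₁ (h a) am , be)
              , (λ { (a , pa , refl) → ∈-map⁺ g (proj₂ (h a) pa) })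

  card-⊎ : {P Q : A → Set} {m n : ℕ} → HasCard P m → HasCard Q n →
           (∀ a → P a → Q a → ⊥) → HasCard (λ a → P a ⊎ Q a) (m + n)
  card-⊎ {P = P} {Q} (L , uL , hL , refl) (M , uM , hM , refl) disjoint =
    L ++ M , ++⁺ uL uM (λ (m₁ , m₂) → disjoint _ (proj₁ (hL _) m₁) (proj₁ (hM _) m₂)) ,
    members , length-++ L
    where
    members : ∀ a → (a ∈ L ++ M → P a ⊎ Q a) × (P a ⊎ Q a → a ∈ L ++ M)
    members a = (λ m → ⊎-map (proj₁ (hL a)) (proj₁ (hM a)) (∈-++⁻ L m))
              , λ { (inj₁ pa) → ∈-++⁺ˡ (proj₂ (hL a) pa) ; (inj₂ qa) → ∈-++⁺ʳ L (proj₂ (hM a) qa) }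

  card-filter : {P Q : A → Set} {n : ℕ} → HasCard P n → (∀ a → Dec (Q a)) →
                Σ ℕ λ k → HasCard (λ a → P a × Q a) k
  card-filter (L , u , h , _) Q? =
    length (filter Q? L) , filter Q? L , filter⁺ Q? u ,
    (λ a → (λ m → let (m₁ , qa) = ∈-filter⁻ Q? m in proj₁ (h a) m₁ , qa)
         , (λ (pa , qa) → ∈-filter⁺ Q? (proj₂ (h a) pa) qa)) , refl

  card-∖ : DecidableEquality A → {P Q : A → Set} {m n : ℕ} →
           HasCard P m → HasCard Q n → (∀ a → Q a → P a) → (∀ a → Dec (Q a)) →
           HasCard (λ a → P a × ¬ Q a) (m ∸ n)
  card-∖ _≟_ {P} {Q} {m} {n} cP cQ Q⊆P Q? with card-filter cP (λ a → ¬? (Q? a))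
  ... | k , cP∖Q = subst (HasCard _) k≡m∸n cP∖Q
    where
    split : ∀ a → P a → (P a × ¬ Q a) ⊎ Q a
    split a pa with Q? a
    ... | yes q = inj₂ q
    ... | no ¬q = inj₁ (pa , ¬q)
    cP' : HasCard P (k + n)
    cP' = card-cong (λ { a (inj₁ x) → proj₁ x ; a (inj₂ q) → Q⊆P a q }) split
                    (card-⊎ cP∖Q cQ (λ a (_ , ¬q) q → ¬q q))
    k≡m∸n : k ≡ m ∸ n
    k≡m∸n = begin
      k           ≡⟨ sym (m+n∸m≡n n k) ⟩
      n + k ∸ n   ≡⟨ cong (_∸ n) (+-comm n k) ⟩
      k + n ∸ n   ≡⟨ cong (_∸ n) (card-unique _≟_ cP' cP) ⟩
      m ∸ n       ∎
      where open ≡-Reasoning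

  module _ {Q : A → B → Set} {m : ℕ} where

    card-pairs-over : (L : List A) → Unique L → (∀ a → a ∈ L → HasCard (Q a) m) →
      HasCard (λ (ab : A × B) → proj₁ ab ∈ L × Q (proj₁ ab) (proj₂ ab)) (length L * m)
    card-pairs-over [] _ _ = [] , [] , (λ _ → (λ ()) , λ { (() , _) }) , refl
    card-pairs-over (a ∷ L) (a∉L ∷ u) cQ =
      card-cong to from (card-⊎ fibre rest disjoint)
      where
      OverL : A × B → Set
      OverL (c , b) = c ∈ L × Q c b
      fibre : HasCard (Image (a ,_) (Q a)) m
      fibre = card-image (a ,_) (λ _ _ → λ { refl → refl }) (cQ a (here refl))
      rest : HasCard OverL (length L * m)
      rest = card-pairs-over L u (λ b m → cQ b (there m))
      disjoint : ∀ ab → Image (a ,_) (Q a) ab → OverL ab → ⊥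
      disjoint _ (_ , _ , refl) (a∈L , _) = Unique[x∷xs]⇒x∉xs (a∉L ∷ u) a∈L
      to : ∀ ab → Image (a ,_) (Q a) ab ⊎ OverL ab → proj₁ ab ∈ a ∷ L × Q (proj₁ ab) (proj₂ ab)
      to _ (inj₁ (_ , q , refl)) = here refl , q
      to _ (inj₂ (a∈L , q)) = there a∈L , q
      from : ∀ ab → proj₁ ab ∈ a ∷ L × Q (proj₁ ab) (proj₂ ab) → Image (a ,_) (Q a) ab ⊎ OverL ab
      from (_ , b) (here refl , q) = inj₁ (b , q , refl)
      from _ (there a∈L , q) = inj₂ (a∈L , q)

    card-Σ : {P : A → Set} {n : ℕ} → HasCard P n → (∀ a → P a → HasCard (Q a) m) →
             HasCard (λ (ab : A × B) → P (proj₁ ab) × Q (proj₁ ab) (proj₂ ab)) (n * m)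
    card-Σ (L , u , h , refl) cQ =
      card-cong (λ _ (a∈L , q) → proj₁ (h _) a∈L , q) (λ _ (pa , q) → proj₂ (h _) pa , q)
                (card-pairs-over L u (λ a a∈L → cQ a (proj₁ (h a) a∈L)))


module PrimeField (p : ℕ) .{{_ : NonZero p}} (p-prime : Prime p) where

  open import Data.Nat using (zero; suc; _+_; _<_; _<?_; z≤n; s≤s; _%_)
  open import Data.Nat.Primality using (prime)
  open import Data.Nat.Base using (nonTrivial⇒n>1; ≢-nonZero)
  open import Data.Nat.Properties
  open import Data.Nat.DivMod
  open import Data.Nat.Divisibility using (n∣m*n)
  open import Data.Nat.Coprimality using (prime⇒coprime; coprime-Bézout)
  open import Data.Nat.GCD using (module Bézout)
  open import Data.Fin using (toℕ)
  open import Data.Fin.Properties using (toℕ-fromℕ<; toℕ-injective; toℕ<n)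
  open import Data.Integer as ℤ using (ℤ; +_; -[1+_]; sign; ∣_∣; _◃_)
  import Data.Integer.Properties as ℤ
  open import Data.Sign as Sign using (Sign)
  open import Data.Maybe using (Maybe; just; nothing)
  open import Data.Product using (Σ; _,_)
  open import Relation.Nullary using (yes; no)
  open import Relation.Binary.PropositionalEquality
  open import Algebra.Bundles using (CommutativeRing)
  open import Algebra.Structures using (IsCommutativeRing)
  open import Algebra.Solver.Ring.AlmostCommutativeRing
    using (fromCommutativeRing; _-Raw-AlmostCommutative⟶_)
  import Algebra.Solver.Ring as RingSolver
  import Algebra.Properties.Ring as RingProperties
  open ≡-Reasoning

  F : Set
  F = 𝔽 p

  infixl 6 _⊕_
  infixl 7 _⊗_
  infix 8 ⊖_

  _⊕_ _⊗_ : F → F → F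
  _⊕_ = _+𝔽_ p
  _⊗_ = _*𝔽_ p

  ⊖_ : F → F
  ⊖_ = -𝔽_ p

  0F 1F : F
  0F = 0𝔽 p
  1F = 1𝔽 p

  1<p : 1 < p
  1<p = prime⇒1<p p-prime
    where
    prime⇒1<p : Prime p → 1 < p
    prime⇒1<p (prime {{nt}} _) = nonTrivial⇒n>1 p {{nt}}

  0<p : 0 < p
  0<p = <-trans (s≤s z≤n) 1<p

  ι : ℕ → F
  ι m = m mod p

  toℕ-ι : ∀ m → toℕ (ι m) ≡ m % p
  toℕ-ι m = toℕ-fromℕ< (m%n<n m p)

  ι-toℕ : ∀ a → ι (toℕ a) ≡ a
  ι-toℕ a = toℕ-injective (trans (toℕ-ι _) (m<n⇒m%n≡m (toℕ<n a)))

  ι-≡ : ∀ {m n} → m % p ≡ n % p → ι m ≡ ι n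
  ι-≡ e = toℕ-injective (trans (toℕ-ι _) (trans e (sym (toℕ-ι _))))

  ι-+ : ∀ m n → ι (m + n) ≡ ι m ⊕ ι n
  ι-+ m n = ι-≡ (trans (%-distribˡ-+ m n p) (sym (cong₂ (λ u v → (u + v) % p) (toℕ-ι m) (toℕ-ι n))))

  ι-* : ∀ m n → ι (m * n) ≡ ι m ⊗ ι n
  ι-* m n = ι-≡ (trans (%-distribˡ-* m n p) (sym (cong₂ (λ u v → (u * v) % p) (toℕ-ι m) (toℕ-ι n))))

  ⊕-ιˡ : ∀ m b → ι m ⊕ b ≡ ι (m + toℕ b)
  ⊕-ιˡ m b = trans (cong (ι m ⊕_) (sym (ι-toℕ b))) (sym (ι-+ m (toℕ b)))

  ⊕-ιʳ : ∀ a n → a ⊕ ι n ≡ ι (toℕ a + n)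
  ⊕-ιʳ a n = trans (cong (_⊕ ι n) (sym (ι-toℕ a))) (sym (ι-+ (toℕ a) n))

  ⊗-ιˡ : ∀ m b → ι m ⊗ b ≡ ι (m * toℕ b)
  ⊗-ιˡ m b = trans (cong (ι m ⊗_) (sym (ι-toℕ b))) (sym (ι-* m (toℕ b)))

  ⊗-ιʳ : ∀ a n → a ⊗ ι n ≡ ι (toℕ a * n)
  ⊗-ιʳ a n = trans (cong (_⊗ ι n) (sym (ι-toℕ a))) (sym (ι-* (toℕ a) n))

  -- The ring laws of 𝔽_p, inherited from those of ℕ through ι.
  ⊕-comm : ∀ a b → a ⊕ b ≡ b ⊕ a
  ⊕-comm a b = cong ι (+-comm (toℕ a) (toℕ b))

  ⊗-comm : ∀ a b → a ⊗ b ≡ b ⊗ a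
  ⊗-comm a b = cong ι (*-comm (toℕ a) (toℕ b))

  ⊕-assoc : ∀ a b c → (a ⊕ b) ⊕ c ≡ a ⊕ (b ⊕ c)
  ⊕-assoc a b c = begin
    ι (toℕ a + toℕ b) ⊕ c        ≡⟨ ⊕-ιˡ _ c ⟩
    ι (toℕ a + toℕ b + toℕ c)    ≡⟨ cong ι (+-assoc (toℕ a) (toℕ b) (toℕ c)) ⟩
    ι (toℕ a + (toℕ b + toℕ c))  ≡⟨ ⊕-ιʳ a _ ⟨
    a ⊕ ι (toℕ b + toℕ c)        ∎

  ⊗-assoc : ∀ a b c → (a ⊗ b) ⊗ c ≡ a ⊗ (b ⊗ c)
  ⊗-assoc a b c = begin
    ι (toℕ a * toℕ b) ⊗ c        ≡⟨ ⊗-ιˡ _ c ⟩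
    ι (toℕ a * toℕ b * toℕ c)    ≡⟨ cong ι (*-assoc (toℕ a) (toℕ b) (toℕ c)) ⟩
    ι (toℕ a * (toℕ b * toℕ c))  ≡⟨ ⊗-ιʳ a _ ⟨
    a ⊗ ι (toℕ b * toℕ c)        ∎

  ⊕-identityʳ : ∀ a → a ⊕ 0F ≡ a
  ⊕-identityʳ a = trans (⊕-ιʳ a 0) (trans (cong ι (+-identityʳ (toℕ a))) (ι-toℕ a))

  ⊕-identityˡ : ∀ a → 0F ⊕ a ≡ a
  ⊕-identityˡ a = trans (⊕-comm 0F a) (⊕-identityʳ a)

  ⊗-identityʳ : ∀ a → a ⊗ 1F ≡ a
  ⊗-identityʳ a = trans (⊗-ιʳ a 1) (trans (cong ι (*-identityʳ (toℕ a))) (ι-toℕ a))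

  ⊗-identityˡ : ∀ a → 1F ⊗ a ≡ a
  ⊗-identityˡ a = trans (⊗-comm 1F a) (⊗-identityʳ a)

  ⊕-inverseʳ : ∀ a → a ⊕ ⊖ a ≡ 0F
  ⊕-inverseʳ a = begin
    a ⊕ ι (p ∸ toℕ a)       ≡⟨ ⊕-ιʳ a _ ⟩
    ι (toℕ a + (p ∸ toℕ a)) ≡⟨ cong ι (m+[n∸m]≡n (<⇒≤ (toℕ<n a))) ⟩
    ι p                     ≡⟨ ι-≡ (trans (n%n≡0 p) (sym (m<n⇒m%n≡m 0<p))) ⟩
    0F                      ∎

  ⊕-inverseˡ : ∀ a → ⊖ a ⊕ a ≡ 0F
  ⊕-inverseˡ a = trans (⊕-comm _ a) (⊕-inverseʳ a)

  ⊗-distribˡ-⊕ : ∀ a b c → a ⊗ (b ⊕ c) ≡ a ⊗ b ⊕ a ⊗ c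
  ⊗-distribˡ-⊕ a b c = begin
    a ⊗ ι (toℕ b + toℕ c)                 ≡⟨ ⊗-ιʳ a _ ⟩
    ι (toℕ a * (toℕ b + toℕ c))           ≡⟨ cong ι (*-distribˡ-+ (toℕ a) (toℕ b) (toℕ c)) ⟩
    ι (toℕ a * toℕ b + toℕ a * toℕ c)     ≡⟨ ι-+ _ _ ⟩
    a ⊗ b ⊕ a ⊗ c                         ∎

  ⊗-distribʳ-⊕ : ∀ a b c → (b ⊕ c) ⊗ a ≡ b ⊗ a ⊕ c ⊗ a
  ⊗-distribʳ-⊕ a b c =
    trans (⊗-comm _ a) (trans (⊗-distribˡ-⊕ a b c) (cong₂ _⊕_ (⊗-comm a b) (⊗-comm a c)))

  isCommutativeRing : IsCommutativeRing _≡_ _⊕_ _⊗_ ⊖_ 0F 1F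
  isCommutativeRing = record
    { isRing = record
      { +-isAbelianGroup = record
        { isGroup = record
          { isMonoid = record
            { isSemigroup = record
              { isMagma = record { isEquivalence = isEquivalence ; ∙-cong = cong₂ _⊕_ }
              ; assoc = ⊕-assoc }
            ; identity = ⊕-identityˡ , ⊕-identityʳ }
          ; inverse = ⊕-inverseˡ , ⊕-inverseʳ
          ; ⁻¹-cong = cong ⊖_ }
        ; comm = ⊕-comm }
      ; *-cong = cong₂ _⊗_
      ; *-assoc = ⊗-assoc
      ; *-identity = ⊗-identityˡ , ⊗-identityʳ
      ; distrib = ⊗-distribˡ-⊕ , ⊗-distribʳ-⊕ }
    ; *-comm = ⊗-comm }

  commutativeRing : CommutativeRing _ _
  commutativeRing = record { isCommutativeRing = isCommutativeRing }

  module CR = CommutativeRing commutativeRing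
  module R = RingProperties CR.ring

  -- The ring map ℤ → 𝔽_p.  It provides the coefficients for the ring solver,
  -- so that identities with the constants 0 and 1 can be normalised.
  ιℤ : ℤ → F
  ιℤ (+ n) = ι n
  ιℤ -[1+ n ] = ⊖ ι (suc n)

  signed : Sign → F → F
  signed Sign.+ a = a
  signed Sign.- a = ⊖ a

  ιℤ-◃ : ∀ s n → ιℤ (s ◃ n) ≡ signed s (ι n)
  ιℤ-◃ Sign.+ zero = refl
  ιℤ-◃ Sign.- zero = sym R.-0#≈0#
  ιℤ-◃ Sign.+ (suc n) = refl
  ιℤ-◃ Sign.- (suc n) = refl

  signed-⊗ : ∀ s t a b → signed s a ⊗ signed t b ≡ signed (s Sign.* t) (a ⊗ b)
  signed-⊗ Sign.+ Sign.+ a b = refl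
  signed-⊗ Sign.+ Sign.- a b = sym (R.-‿distribʳ-* a b)
  signed-⊗ Sign.- Sign.+ a b = sym (R.-‿distribˡ-* a b)
  signed-⊗ Sign.- Sign.- a b =
    trans (sym (R.-‿distribˡ-* a (⊖ b)))
          (trans (cong ⊖_ (sym (R.-‿distribʳ-* a b))) (R.-‿involutive _))

  ιℤ-* : ∀ i j → ιℤ (i ℤ.* j) ≡ ιℤ i ⊗ ιℤ j
  ιℤ-* i j = begin
    ιℤ (sign i Sign.* sign j ◃ ∣ i ∣ * ∣ j ∣)           ≡⟨ ιℤ-◃ (sign i Sign.* sign j) (∣ i ∣ * ∣ j ∣) ⟩
    signed (sign i Sign.* sign j) (ι (∣ i ∣ * ∣ j ∣))    ≡⟨ cong (signed (sign i Sign.* sign j)) (ι-* ∣ i ∣ ∣ j ∣) ⟩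
    signed (sign i Sign.* sign j) (ι ∣ i ∣ ⊗ ι ∣ j ∣)    ≡⟨ signed-⊗ (sign i) (sign j) _ _ ⟨
    signed (sign i) (ι ∣ i ∣) ⊗ signed (sign j) (ι ∣ j ∣) ≡⟨ cong₂ _⊗_ (signed-abs i) (signed-abs j) ⟩
    ιℤ i ⊗ ιℤ j                                          ∎
    where
    signed-abs : ∀ i → signed (sign i) (ι ∣ i ∣) ≡ ιℤ i
    signed-abs (+ n) = refl
    signed-abs -[1+ n ] = refl

  ιℤ-neg : ∀ i → ιℤ (ℤ.- i) ≡ ⊖ ιℤ i
  ιℤ-neg (+ zero) = sym R.-0#≈0#
  ιℤ-neg (+ suc n) = refl
  ιℤ-neg -[1+ n ] = sym (R.-‿involutive _)

  ιℤ-⊖ : ∀ m n → ιℤ (m ℤ.⊖ n) ≡ ι m ⊕ ⊖ ι n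
  ιℤ-⊖ m n with m <? n
  ... | no m≮n = begin
    ιℤ (m ℤ.⊖ n)                   ≡⟨ cong ιℤ (ℤ.⊖-≥ (≮⇒≥ m≮n)) ⟩
    ι (m ∸ n)                      ≡⟨ ⊕-identityʳ _ ⟨
    ι (m ∸ n) ⊕ 0F                 ≡⟨ cong (ι (m ∸ n) ⊕_) (⊕-inverseʳ (ι n)) ⟨
    ι (m ∸ n) ⊕ (ι n ⊕ ⊖ ι n)      ≡⟨ ⊕-assoc _ _ _ ⟨
    ι (m ∸ n) ⊕ ι n ⊕ ⊖ ι n        ≡⟨ cong (λ t → t ⊕ ⊖ ι n) (sym (ι-+ (m ∸ n) n)) ⟩
    ι (m ∸ n + n) ⊕ ⊖ ι n          ≡⟨ cong (λ t → ι t ⊕ ⊖ ι n) (m∸n+n≡m (≮⇒≥ m≮n)) ⟩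
    ι m ⊕ ⊖ ι n                    ∎
  ... | yes m<n = begin
    ιℤ (m ℤ.⊖ n)                   ≡⟨ cong ιℤ (ℤ.⊖-< m<n) ⟩
    ιℤ (ℤ.- (+ (n ∸ m)))           ≡⟨ ιℤ-neg (+ (n ∸ m)) ⟩
    ⊖ ι (n ∸ m)                    ≡⟨ R.+-inverseˡ-unique _ _ sum≡0 ⟨
    ι m ⊕ ⊖ ι n                    ∎
    where
    sum≡0 : ι m ⊕ ⊖ ι n ⊕ ι (n ∸ m) ≡ 0F
    sum≡0 = begin
      ι m ⊕ ⊖ ι n ⊕ ι (n ∸ m)     ≡⟨ cong (_⊕ ι (n ∸ m)) (⊕-comm (ι m) (⊖ ι n)) ⟩
      ⊖ ι n ⊕ ι m ⊕ ι (n ∸ m)     ≡⟨ ⊕-assoc (⊖ ι n) (ι m) (ι (n ∸ m)) ⟩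
      ⊖ ι n ⊕ (ι m ⊕ ι (n ∸ m))   ≡⟨ cong (⊖ ι n ⊕_) (sym (ι-+ m (n ∸ m))) ⟩
      ⊖ ι n ⊕ ι (m + (n ∸ m))     ≡⟨ cong (λ t → ⊖ ι n ⊕ ι t) (m+[n∸m]≡n (<⇒≤ m<n)) ⟩
      ⊖ ι n ⊕ ι n                 ≡⟨ ⊕-inverseˡ _ ⟩
      0F                          ∎

  ιℤ-+ : ∀ i j → ιℤ (i ℤ.+ j) ≡ ιℤ i ⊕ ιℤ j
  ιℤ-+ -[1+ m ] -[1+ n ] = begin
    ⊖ ι (suc (suc (m + n)))        ≡⟨ cong (λ t → ⊖ ι (suc t)) (sym (+-suc m n)) ⟩
    ⊖ ι (suc m + suc n)            ≡⟨ cong ⊖_ (ι-+ (suc m) (suc n)) ⟩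
    ⊖ (ι (suc m) ⊕ ι (suc n))      ≡⟨ R.-‿+-comm (ι (suc m)) (ι (suc n)) ⟨
    ⊖ ι (suc m) ⊕ ⊖ ι (suc n)      ∎
  ιℤ-+ -[1+ m ] (+ n) = trans (ιℤ-⊖ n (suc m)) (⊕-comm (ι n) (⊖ ι (suc m)))
  ιℤ-+ (+ m) -[1+ n ] = ιℤ-⊖ m (suc n)
  ιℤ-+ (+ m) (+ n) = ι-+ m n

  ιℤ-hom : ℤ.+-*-rawRing -Raw-AlmostCommutative⟶ fromCommutativeRing commutativeRing
  ιℤ-hom = record
    { ⟦_⟧ = ιℤ ; +-homo = ιℤ-+ ; *-homo = ιℤ-* ; -‿homo = ιℤ-neg ; 0-homo = refl ; 1-homo = refl }

  ιℤ-≟ : ∀ i j → Maybe (ιℤ i ≡ ιℤ j)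
  ιℤ-≟ i j with i ℤ.≟ j
  ... | yes e = just (cong ιℤ e)
  ... | no _ = nothing

  open RingSolver ℤ.+-*-rawRing (fromCommutativeRing commutativeRing) ιℤ-hom ιℤ-≟ public
    using (solve; _:=_; _:+_; _:*_; :-_; con)

  toℕ-0F : toℕ 0F ≡ 0
  toℕ-0F = trans (toℕ-ι 0) (m<n⇒m%n≡m 0<p)

  toℕ-1F : toℕ 1F ≡ 1
  toℕ-1F = trans (toℕ-ι 1) (m<n⇒m%n≡m 1<p)

  1≢0 : 1F ≢ 0F
  1≢0 e with trans (sym toℕ-1F) (trans (cong toℕ e) toℕ-0F)
  ... | ()

  -- Every non-zero a has an inverse, obtained from a Bézout identity for the
  -- coprime pair (a, p).
  ⊗-inverse : (a : F) → a ≢ 0F → Σ F λ b → a ⊗ b ≡ 1F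
  ⊗-inverse a a≢0 with coprime-Bézout (prime⇒coprime p-prime {{a≠0}} (toℕ<n a))
    where
    a≠0 : NonZero (toℕ a)
    a≠0 = ≢-nonZero (λ e → a≢0 (toℕ-injective (trans e (sym toℕ-0F))))
  ... | Bézout.+- x y 1+ya≡xp = ⊖ ι y , (begin
    a ⊗ ⊖ ι y           ≡⟨ R.-‿distribʳ-* a (ι y) ⟨
    ⊖ (a ⊗ ι y)         ≡⟨ cong ⊖_ (R.+-inverseʳ-unique 1F (a ⊗ ι y) 1+ay≡0) ⟩
    ⊖ ⊖ 1F              ≡⟨ R.-‿involutive 1F ⟩
    1F                  ∎)
    where
    1+ay≡0 : 1F ⊕ a ⊗ ι y ≡ 0F
    1+ay≡0 = begin
      1F ⊕ a ⊗ ι y              ≡⟨ cong (1F ⊕_) (⊗-ιʳ a y) ⟩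
      ι 1 ⊕ ι (toℕ a * y)       ≡⟨ ι-+ 1 _ ⟨
      ι (1 + toℕ a * y)         ≡⟨ cong (λ t → ι (1 + t)) (*-comm (toℕ a) y) ⟩
      ι (1 + y * toℕ a)         ≡⟨ cong ι 1+ya≡xp ⟩
      ι (x * p)                 ≡⟨ ι-≡ (trans (m*n%n≡0 x p) (sym (m<n⇒m%n≡m 0<p))) ⟩
      0F                        ∎
  ... | Bézout.-+ x y 1+xp≡ya = ι y , (begin
    a ⊗ ι y                   ≡⟨ ⊗-ιʳ a y ⟩
    ι (toℕ a * y)             ≡⟨ cong ι (*-comm (toℕ a) y) ⟩
    ι (y * toℕ a)             ≡⟨ cong ι 1+xp≡ya ⟨
    ι (1 + x * p)             ≡⟨ ι-≡ (%-remove-+ʳ 1 (n∣m*n x)) ⟩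
    1F                        ∎)

  ⊗-cancel-zero : ∀ a b → a ⊗ b ≡ 0F → b ≢ 0F → a ≡ 0F
  ⊗-cancel-zero a b ab≡0 b≢0 with ⊗-inverse b b≢0
  ... | b⁻¹ , bb⁻¹≡1 = begin
    a                 ≡⟨ ⊗-identityʳ a ⟨
    a ⊗ 1F            ≡⟨ cong (a ⊗_) bb⁻¹≡1 ⟨
    a ⊗ (b ⊗ b⁻¹)     ≡⟨ ⊗-assoc a b b⁻¹ ⟨
    a ⊗ b ⊗ b⁻¹       ≡⟨ cong (_⊗ b⁻¹) ab≡0 ⟩
    0F ⊗ b⁻¹          ≡⟨ CR.zeroˡ b⁻¹ ⟩
    0F                ∎

  1≡-1⇒p≡2 : 1F ≡ ⊖ 1F → p ≡ 2
  1≡-1⇒p≡2 e = 1≡p-1⇒p≡2 p 1<p (begin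
    1                   ≡⟨ toℕ-1F ⟨
    toℕ 1F              ≡⟨ cong toℕ e ⟩
    toℕ (ι (p ∸ toℕ 1F)) ≡⟨ toℕ-ι _ ⟩
    (p ∸ toℕ 1F) % p    ≡⟨ cong (λ t → (p ∸ t) % p) toℕ-1F ⟩
    (p ∸ 1) % p         ≡⟨ m<n⇒m%n≡m (∸-monoʳ-< (s≤s z≤n) (<⇒≤ 1<p)) ⟩
    p ∸ 1               ∎)
    where
    1≡p-1⇒p≡2 : ∀ k → 1 < k → 1 ≡ k ∸ 1 → k ≡ 2
    1≡p-1⇒p≡2 (suc (suc zero)) _ _ = refl
    1≡p-1⇒p≡2 (suc (suc (suc k))) _ ()

  p≡2⇒⊗-idem : p ≡ 2 → ∀ a → a ⊗ a ≡ a
  p≡2⇒⊗-idem p≡2 a = trans (cong ι (bit-idem (toℕ a) (subst (toℕ a <_) p≡2 (toℕ<n a)))) (ι-toℕ a)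
    where
    bit-idem : ∀ k → k < 2 → k * k ≡ k
    bit-idem zero _ = refl
    bit-idem (suc zero) _ = refl
    bit-idem (suc (suc k)) (s≤s (s≤s ()))


module VectorSpace (p : ℕ) .{{_ : NonZero p}} (p-prime : Prime p) where

  open Counting
  open PrimeField p p-prime
  open import Data.Nat using (zero; suc)
  open import Data.Nat.Properties using (*-cancelˡ-≡)
  open import Data.Fin using (Fin; zero; suc) renaming (_≟_ to _≟F_)
  import Data.Fin.Properties as FinP
  open import Data.Vec using ([]; _∷_; lookup)
  open import Data.Vec.Properties using () renaming (≡-dec to Vec-≡-dec)
  open import Data.List using (List; []; _∷_; allFin; tabulate)
  open import Data.List.Properties using (length-tabulate)
  open import Data.List.Membership.Propositional using (_∈_)
  open import Data.List.Membership.Propositional.Properties using (∈-allFin; ∈-tabulate⁻)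
  open import Data.List.Relation.Unary.Any using (here; there)
  open import Data.List.Relation.Unary.Unique.Propositional.Properties using (allFin⁺)
  open import Data.Product using (Σ; _×_; _,_; proj₁; proj₂)
  open import Data.Unit using (⊤; tt)
  open import Data.Empty using (⊥-elim)
  open import Relation.Nullary using (¬_; Dec; yes; no)
  open import Relation.Binary.Definitions using (DecidableEquality)
  open import Relation.Binary.PropositionalEquality
  open import Data.Integer using (+_)
  open ≡-Reasoning

  V : ℕ → Set
  V n = Vect p n

  infixl 6 _+v_
  infixr 7 _·_

  _+v_ : ∀ {n} → V n → V n → V n
  _+v_ = _+V_ p

  _·_ : ∀ {n} → F → V n → V n
  _·_ = _·V_ p

  0v : ∀ n → V n
  0v = 0V p

  _≟V_ : ∀ {n} → DecidableEquality (V n)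
  _≟V_ = Vec-≡-dec _≟F_

  card-F : HasCard {F} (λ _ → ⊤) p
  card-F = allFin p , allFin⁺ p , (λ a → (λ _ → tt) , (λ _ → ∈-allFin a)) , length-tabulate _

  -- |𝔽_p^n| = p^n, since a ∷ v ranges over 𝔽_p × 𝔽_p^n.
  card-V : ∀ n → HasCard {V n} (λ _ → ⊤) (p ^ n)
  card-V zero = card-cong (λ _ _ → tt) (λ { [] _ → refl }) (card-singleton [])
  card-V (suc n) = card-cong (λ _ _ → tt) (λ { (a ∷ v) _ → (a , v) , (tt , tt) , refl })
    (card-image (λ (a , v) → a ∷ v) (λ { _ _ refl → refl }) (card-Σ card-F (λ _ _ → card-V n)))

  ·-zeroˡ : ∀ {n} (v : V n) → 0F · v ≡ 0v n
  ·-zeroˡ [] = refl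
  ·-zeroˡ (x ∷ xs) = cong₂ _∷_ (CR.zeroˡ x) (·-zeroˡ xs)

  ·-zeroʳ : ∀ {n} a → a · 0v n ≡ 0v n
  ·-zeroʳ {zero} a = refl
  ·-zeroʳ {suc n} a = cong₂ _∷_ (CR.zeroʳ a) (·-zeroʳ a)

  ·-identityˡ : ∀ {n} (v : V n) → 1F · v ≡ v
  ·-identityˡ [] = refl
  ·-identityˡ (x ∷ xs) = cong₂ _∷_ (⊗-identityˡ x) (·-identityˡ xs)

  +v-identityˡ : ∀ {n} (v : V n) → 0v n +v v ≡ v
  +v-identityˡ [] = refl
  +v-identityˡ (x ∷ xs) = cong₂ _∷_ (⊕-identityˡ x) (+v-identityˡ xs)

  +v-identityʳ : ∀ {n} (v : V n) → v +v 0v n ≡ v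
  +v-identityʳ [] = refl
  +v-identityʳ (x ∷ xs) = cong₂ _∷_ (⊕-identityʳ x) (+v-identityʳ xs)

  ·-assoc : ∀ {n} a b (v : V n) → (a ⊗ b) · v ≡ a · b · v
  ·-assoc a b [] = refl
  ·-assoc a b (x ∷ xs) = cong₂ _∷_ (⊗-assoc a b x) (·-assoc a b xs)

  ·-inverse : ∀ {n} a (v : V n) → a · v +v ⊖ a · v ≡ 0v n
  ·-inverse a [] = refl
  ·-inverse a (x ∷ xs) = cong₂ _∷_
    (solve 2 (λ a x → a :* x :+ (:- a) :* x := con (+ 0)) refl a x) (·-inverse a xs)

  ·-distrib-⊖ : ∀ {n} a b (v : V n) → (a ⊕ ⊖ b) · v ≡ a · v +v ⊖ b · v
  ·-distrib-⊖ a b [] = refl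
  ·-distrib-⊖ a b (x ∷ xs) = cong₂ _∷_
    (solve 3 (λ a b x → (a :+ :- b) :* x := a :* x :+ (:- b) :* x) refl a b x) (·-distrib-⊖ a b xs)

  ·-cancel : ∀ {n} c (y : V n) → c · y ≡ 0v n → c ≢ 0F → y ≡ 0v n
  ·-cancel {n} c y cy≡0 c≢0 with ⊗-inverse c c≢0
  ... | c⁻¹ , cc⁻¹≡1 = begin
    y                ≡⟨ ·-identityˡ y ⟨
    1F · y           ≡⟨ cong (_· y) (trans (⊗-comm c⁻¹ c) cc⁻¹≡1) ⟨
    (c⁻¹ ⊗ c) · y    ≡⟨ ·-assoc c⁻¹ c y ⟩
    c⁻¹ · c · y      ≡⟨ cong (c⁻¹ ·_) cy≡0 ⟩
    c⁻¹ · 0v n       ≡⟨ ·-zeroʳ c⁻¹ ⟩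
    0v n             ∎

  ·-injective : ∀ {n} {y : V n} → y ≢ 0v n → ∀ {a b} → a · y ≡ b · y → a ≡ b
  ·-injective {n} {y} y≢0 {a} {b} ay≡by with (a ⊕ ⊖ b) ≟F 0F
  ... | yes a-b≡0 = R.x∙y⁻¹≈ε⇒x≈y a b a-b≡0
  ... | no a-b≢0 = ⊥-elim (y≢0 (·-cancel (a ⊕ ⊖ b) y a-b·y≡0 a-b≢0))
    where
    a-b·y≡0 : (a ⊕ ⊖ b) · y ≡ 0v n
    a-b·y≡0 = begin
      (a ⊕ ⊖ b) · y       ≡⟨ ·-distrib-⊖ a b y ⟩
      a · y +v ⊖ b · y    ≡⟨ cong (_+v ⊖ b · y) ay≡by ⟩
      b · y +v ⊖ b · y    ≡⟨ ·-inverse b y ⟩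
      0v n                ∎

  +v-comm : ∀ {n} (u v : V n) → u +v v ≡ v +v u
  +v-comm [] [] = refl
  +v-comm (x ∷ xs) (y ∷ ys) = cong₂ _∷_ (⊕-comm x y) (+v-comm xs ys)

  ·-distribˡ : ∀ {n} a (u v : V n) → a · (u +v v) ≡ a · u +v a · v
  ·-distribˡ a [] [] = refl
  ·-distribˡ a (x ∷ xs) (y ∷ ys) = cong₂ _∷_ (⊗-distribˡ-⊕ a x y) (·-distribˡ a xs ys)

  isolate : ∀ {n} (c c⁻¹ : F) (z w : V n) → c ⊗ c⁻¹ ≡ 1F → c · z +v w ≡ 0v n → z ≡ ⊖ c⁻¹ · w
  isolate {n} c c⁻¹ z w cc⁻¹≡1 rel = begin
    z                                ≡⟨ ·-identityˡ z ⟨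
    1F · z                           ≡⟨ cong (_· z) (trans (⊗-comm c⁻¹ c) cc⁻¹≡1) ⟨
    (c⁻¹ ⊗ c) · z                    ≡⟨ expand z w ⟩
    c⁻¹ · (c · z +v w) +v ⊖ c⁻¹ · w  ≡⟨ cong (λ t → c⁻¹ · t +v ⊖ c⁻¹ · w) rel ⟩
    c⁻¹ · 0v n +v ⊖ c⁻¹ · w          ≡⟨ cong (_+v ⊖ c⁻¹ · w) (·-zeroʳ c⁻¹) ⟩
    0v n +v ⊖ c⁻¹ · w                ≡⟨ +v-identityˡ _ ⟩
    ⊖ c⁻¹ · w                        ∎
    where
    expand : ∀ {m} (z w : V m) → (c⁻¹ ⊗ c) · z ≡ c⁻¹ · (c · z +v w) +v ⊖ c⁻¹ · w
    expand [] [] = refl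
    expand (z ∷ zs) (w ∷ ws) = cong₂ _∷_
      (solve 4 (λ d c z w → (d :* c) :* z := d :* (c :* z :+ w) :+ (:- d) :* w) refl c⁻¹ c z w)
      (expand zs ws)

  lin₂ : ∀ {n} → V n → V n → F × F → V n
  lin₂ x y (a , b) = a · x +v b · y

  InLine : ∀ {n} → V n → V n → Set
  InLine y w = Σ F λ a → w ≡ a · y

  InPlane : ∀ {n} → V n → V n → V n → Set
  InPlane x y w = Σ (F × F) λ ab → w ≡ lin₂ x y ab

  inLine? : ∀ {n} (y w : V n) → Dec (InLine y w)
  inLine? y w = FinP.any? (λ a → w ≟V (a · y))

  inPlane? : ∀ {n} (x y w : V n) → Dec (InPlane x y w)
  inPlane? x y w with FinP.any? (λ a → FinP.any? (λ b → w ≟V lin₂ x y (a , b)))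
  ... | yes (a , b , e) = yes ((a , b) , e)
  ... | no ∄ab = no (λ ((a , b) , e) → ∄ab (a , b , e))

  independent₂ : ∀ {n} {x y : V n} → y ≢ 0v n → ¬ InLine y x →
                 ∀ a b → a · x +v b · y ≡ 0v n → (a ≡ 0F) × (b ≡ 0F)
  independent₂ {n} {x} {y} y≢0 x∉⟨y⟩ a b rel with a ≟F 0F
  ... | no a≢0 = let (a⁻¹ , aa⁻¹≡1) = ⊗-inverse a a≢0 in
    ⊥-elim (x∉⟨y⟩ (⊖ a⁻¹ ⊗ b , trans (isolate a a⁻¹ x (b · y) aa⁻¹≡1 rel) (sym (·-assoc (⊖ a⁻¹) b y))))
  ... | yes a≡0 with b ≟F 0F
  ...   | yes b≡0 = a≡0 , b≡0
  ...   | no b≢0 = ⊥-elim (y≢0 (·-cancel b y by≡0 b≢0))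
    where
    by≡0 : b · y ≡ 0v n
    by≡0 = begin
      b · y               ≡⟨ +v-identityˡ (b · y) ⟨
      0v n +v b · y       ≡⟨ cong (_+v b · y) (·-zeroˡ x) ⟨
      0F · x +v b · y     ≡⟨ cong (λ c → c · x +v b · y) a≡0 ⟨
      a · x +v b · y      ≡⟨ rel ⟩
      0v n                ∎

  lin₂-injective : ∀ {n} {x y : V n} → y ≢ 0v n → ¬ InLine y x →
                   ∀ {ab ab'} → lin₂ x y ab ≡ lin₂ x y ab' → ab ≡ ab'
  lin₂-injective {n} {x} {y} y≢0 x∉⟨y⟩ {a , b} {a' , b'} e =
    let (a-a'≡0 , b-b'≡0) = independent₂ y≢0 x∉⟨y⟩ (a ⊕ ⊖ a') (b ⊕ ⊖ b') difference≡0
    in cong₂ _,_ (R.x∙y⁻¹≈ε⇒x≈y a a' a-a'≡0) (R.x∙y⁻¹≈ε⇒x≈y b b' b-b'≡0)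
    where
    split : ∀ {m} (x y : V m) →
      (a ⊕ ⊖ a') · x +v (b ⊕ ⊖ b') · y ≡ (a · x +v b · y) +v (⊖ a' · x +v ⊖ b' · y)
    split [] [] = refl
    split (x ∷ xs) (y ∷ ys) = cong₂ _∷_
      (solve 6 (λ a b a' b' x y → (a :+ :- a') :* x :+ (b :+ :- b') :* y :=
         (a :* x :+ b :* y) :+ ((:- a') :* x :+ (:- b') :* y)) refl a b a' b' x y)
      (split xs ys)
    cancel : ∀ {m} (x y : V m) → (a' · x +v b' · y) +v (⊖ a' · x +v ⊖ b' · y) ≡ 0v m
    cancel [] [] = refl
    cancel (x ∷ xs) (y ∷ ys) = cong₂ _∷_
      (solve 4 (λ a' b' x y → (a' :* x :+ b' :* y) :+ ((:- a') :* x :+ (:- b') :* y) := con (+ 0))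
         refl a' b' x y)
      (cancel xs ys)
    difference≡0 : (a ⊕ ⊖ a') · x +v (b ⊕ ⊖ b') · y ≡ 0v n
    difference≡0 = trans (split x y) (trans (cong (_+v (⊖ a' · x +v ⊖ b' · y)) e) (cancel x y))

  independent₃⇒ : ∀ {n} {x y z : V n} → LinIndep3 p n x y z →
                  (y ≢ 0v n) × ¬ InLine y x × ¬ InPlane x y z
  independent₃⇒ {n} {x} {y} {z} indep = y≢0 , x∉⟨y⟩ , z∉⟨x,y⟩
    where
    y≢0 : y ≢ 0v n
    y≢0 refl = 1≢0 (proj₁ (proj₂ (indep 0F 1F 0F (relation x z))))
      where
      relation : ∀ {m} (x z : V m) → (0F · x +v 1F · 0v m) +v 0F · z ≡ 0v m
      relation [] [] = refl
      relation (x ∷ xs) (z ∷ zs) = cong₂ _∷_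
        (solve 2 (λ x z → (con (+ 0) :* x :+ con (+ 1) :* con (+ 0)) :+ con (+ 0) :* z := con (+ 0))
           refl x z)
        (relation xs zs)
    x∉⟨y⟩ : ¬ InLine y x
    x∉⟨y⟩ (a , refl) = 1≢0 (proj₁ (indep 1F (⊖ a) 0F (relation y z)))
      where
      relation : ∀ {m} (y z : V m) → (1F · a · y +v ⊖ a · y) +v 0F · z ≡ 0v m
      relation [] [] = refl
      relation (y ∷ ys) (z ∷ zs) = cong₂ _∷_
        (solve 3 (λ a y z → (con (+ 1) :* (a :* y) :+ (:- a) :* y) :+ con (+ 0) :* z := con (+ 0))
           refl a y z)
        (relation ys zs)
    z∉⟨x,y⟩ : ¬ InPlane x y z
    z∉⟨x,y⟩ ((a , b) , refl) = 1≢0 (proj₂ (proj₂ (indep (⊖ a) (⊖ b) 1F (relation x y))))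
      where
      relation : ∀ {m} (x y : V m) → (⊖ a · x +v ⊖ b · y) +v 1F · (a · x +v b · y) ≡ 0v m
      relation [] [] = refl
      relation (x ∷ xs) (y ∷ ys) = cong₂ _∷_
        (solve 4 (λ a b x y → ((:- a) :* x :+ (:- b) :* y) :+ con (+ 1) :* (a :* x :+ b :* y) := con (+ 0))
           refl a b x y)
        (relation xs ys)

  ⇒independent₃ : ∀ {n} {x y z : V n} → y ≢ 0v n → ¬ InLine y x → ¬ InPlane x y z →
                  LinIndep3 p n x y z
  ⇒independent₃ {n} {x} {y} {z} y≢0 x∉⟨y⟩ z∉⟨x,y⟩ a b c rel with c ≟F 0F
  ... | yes c≡0 = let (a≡0 , b≡0) = independent₂ y≢0 x∉⟨y⟩ a b (trans drop-z rel) in a≡0 , b≡0 , c≡0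
    where
    drop-z : a · x +v b · y ≡ (a · x +v b · y) +v c · z
    drop-z = begin
      a · x +v b · y                  ≡⟨ +v-identityʳ _ ⟨
      (a · x +v b · y) +v 0v n        ≡⟨ cong ((a · x +v b · y) +v_) (·-zeroˡ z) ⟨
      (a · x +v b · y) +v 0F · z      ≡⟨ cong (λ t → (a · x +v b · y) +v t · z) c≡0 ⟨
      (a · x +v b · y) +v c · z       ∎
  ... | no c≢0 = let (c⁻¹ , cc⁻¹≡1) = ⊗-inverse c c≢0 in
    ⊥-elim (z∉⟨x,y⟩ ((⊖ c⁻¹ ⊗ a , ⊖ c⁻¹ ⊗ b) , (begin
      z                                      ≡⟨ isolate c c⁻¹ z _ cc⁻¹≡1 (trans (+v-comm _ _) rel) ⟩
      ⊖ c⁻¹ · (a · x +v b · y)               ≡⟨ ·-distribˡ (⊖ c⁻¹) (a · x) (b · y) ⟩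
      ⊖ c⁻¹ · a · x +v ⊖ c⁻¹ · b · y         ≡⟨ cong₂ _+v_ (·-assoc (⊖ c⁻¹) a x) (·-assoc (⊖ c⁻¹) b y) ⟨
      (⊖ c⁻¹ ⊗ a) · x +v (⊖ c⁻¹ ⊗ b) · y     ∎)))

  record Linear {n : ℕ} (f : V n → F) : Set where
    field
      additive    : ∀ u v → f (u +v v) ≡ f u ⊕ f v
      homogeneous : ∀ a v → f (a · v) ≡ a ⊗ f v

  linear-zero : ∀ {n} {f : V n → F} → Linear f → f (0v n) ≡ 0F
  linear-zero {n} {f} lin = begin
    f (0v n)         ≡⟨ cong f (·-zeroˡ (0v n)) ⟨
    f (0F · 0v n)    ≡⟨ Linear.homogeneous lin 0F (0v n) ⟩
    0F ⊗ f (0v n)    ≡⟨ CR.zeroˡ _ ⟩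
    0F               ∎

  -- A functional f with f u = 1 splits 𝔽_p^n as ⟨u⟩ ⊕ ker f: the map
  -- (t , k) ↦ t · u + k is a bijection 𝔽_p × ker f ≅ 𝔽_p^n.
  module Splitting {n : ℕ} {f : V n → F} (lin : Linear f) (u : V n) (fu≡1 : f u ≡ 1F) where
    open Linear lin

    InKernel : F × V n → Set
    InKernel (_ , k) = ⊤ × f k ≡ 0F

    join : F × V n → V n
    join (t , k) = t · u +v k

    f-join : ∀ t k → f k ≡ 0F → f (join (t , k)) ≡ t
    f-join t k fk≡0 = begin
      f (t · u +v k)        ≡⟨ additive (t · u) k ⟩
      f (t · u) ⊕ f k       ≡⟨ cong₂ _⊕_ (homogeneous t u) fk≡0 ⟩
      t ⊗ f u ⊕ 0F          ≡⟨ cong (λ s → t ⊗ s ⊕ 0F) fu≡1 ⟩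
      t ⊗ 1F ⊕ 0F           ≡⟨ trans (⊕-identityʳ _) (⊗-identityʳ t) ⟩
      t                     ∎

    join-injective : ∀ {tk tk'} → InKernel tk → InKernel tk' → join tk ≡ join tk' → tk ≡ tk'
    join-injective {t , k} {t' , k'} (_ , fk≡0) (_ , fk'≡0) e = cong₂ _,_ t≡t' (begin
      k                                ≡⟨ recover t u k ⟩
      (t · u +v k) +v ⊖ t · u          ≡⟨ cong (_+v ⊖ t · u) e ⟩
      (t' · u +v k') +v ⊖ t · u        ≡⟨ cong (λ s → (s · u +v k') +v ⊖ t · u) t≡t' ⟨
      (t · u +v k') +v ⊖ t · u         ≡⟨ recover t u k' ⟨
      k'                               ∎)
      where
      t≡t' : t ≡ t'
      t≡t' = trans (sym (f-join t k fk≡0)) (trans (cong f e) (f-join t' k' fk'≡0))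
      recover : ∀ {m} t (u k : V m) → k ≡ (t · u +v k) +v ⊖ t · u
      recover t [] [] = refl
      recover t (u ∷ us) (k ∷ ks) = cong₂ _∷_
        (solve 3 (λ t u k → k := (t :* u :+ k) :+ (:- t) :* u) refl t u k) (recover t us ks)

    join-surjective : ∀ v → Image join InKernel v
    join-surjective v = (f v , v +v ⊖ f v · u) , (tt , f-rest≡0) , split (f v) u v
      where
      split : ∀ {m} s (u v : V m) → v ≡ s · u +v (v +v ⊖ s · u)
      split s [] [] = refl
      split s (u ∷ us) (v ∷ vs) = cong₂ _∷_
        (solve 3 (λ s u v → v := s :* u :+ (v :+ (:- s) :* u)) refl s u v) (split s us vs)
      f-rest≡0 : f (v +v ⊖ f v · u) ≡ 0F
      f-rest≡0 = begin
        f (v +v ⊖ f v · u)         ≡⟨ additive v _ ⟩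
        f v ⊕ f (⊖ f v · u)        ≡⟨ cong (f v ⊕_) (homogeneous (⊖ f v) u) ⟩
        f v ⊕ ⊖ f v ⊗ f u          ≡⟨ cong (λ s → f v ⊕ ⊖ f v ⊗ s) fu≡1 ⟩
        f v ⊕ ⊖ f v ⊗ 1F           ≡⟨ cong (f v ⊕_) (⊗-identityʳ _) ⟩
        f v ⊕ ⊖ f v                ≡⟨ ⊕-inverseʳ (f v) ⟩
        0F                         ∎

  -- A non-zero functional on 𝔽_p^(n+1) has a kernel of size p^n, because
  -- the splitting gives p · |ker f| = p^(n+1).
  kernel-card : ∀ n (f : V (suc n) → F) → Linear f → (w : V (suc n)) → f w ≢ 0F →
                HasCard (λ v → f v ≡ 0F) (p ^ n)
  kernel-card n f lin w fw≢0 with ⊗-inverse (f w) fw≢0 | card-filter (card-V (suc n)) (λ v → f v ≟F 0F)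
  ... | c , fw·c≡1 | K , card-ker⊤ = subst (HasCard _) K≡p^n card-ker
    where
    open Splitting lin (c · w) (trans (Linear.homogeneous lin c w) (trans (⊗-comm c (f w)) fw·c≡1))
    card-ker : HasCard (λ v → f v ≡ 0F) K
    card-ker = card-cong (λ _ → proj₂) (λ _ e → tt , e) card-ker⊤
    card-all : HasCard {V (suc n)} (λ _ → ⊤) (p * K)
    card-all = card-cong (λ _ _ → tt) (λ v _ → join-surjective v)
                 (card-image join join-injective (card-Σ card-F (λ _ _ → card-ker)))
    K≡p^n : K ≡ p ^ n
    K≡p^n = *-cancelˡ-≡ K (p ^ n) p (card-unique _≟V_ card-all (card-V (suc n)))

  sumV : ∀ {n} → List (V n) → V n
  sumV [] = 0v _
  sumV (v ∷ vs) = v +v sumV vs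

  coordinates : ∀ {n} → V n → List (V n)
  coordinates {n} v = tabulate (λ i → lookup v i · basis p n i)

  basis-expansion : ∀ {n} (v : V n) → v ≡ sumV (coordinates v)
  basis-expansion [] = refl
  basis-expansion {suc n} (a ∷ v) = sym (begin
    a · (1F ∷ 0v n) +v sumV (tabulate (λ i → lookup v i · (0F ∷ basis p n i)))
      ≡⟨ cong (a · (1F ∷ 0v n) +v_) (sum-cons-zero (lookup v) (basis p n)) ⟩
    a · (1F ∷ 0v n) +v (0F ∷ sumV (coordinates v))
      ≡⟨ cong₂ _∷_ (trans (⊕-identityʳ _) (⊗-identityʳ a))
                   (trans (cong (_+v sumV (coordinates v)) (·-zeroʳ a)) (+v-identityˡ _)) ⟩
    a ∷ sumV (coordinates v)
      ≡⟨ cong (a ∷_) (basis-expansion v) ⟨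
    a ∷ v ∎)
    where
    sum-cons-zero : ∀ {k m} (c : Fin k → F) (g : Fin k → V m) →
      sumV (tabulate (λ i → c i · (0F ∷ g i))) ≡ 0F ∷ sumV (tabulate (λ i → c i · g i))
    sum-cons-zero {zero} c g = refl
    sum-cons-zero {suc k} c g = trans
      (cong (c zero · (0F ∷ g zero) +v_) (sum-cons-zero (λ i → c (suc i)) (λ i → g (suc i))))
      (cong (_∷ sumV (tabulate (λ i → c i · g i))) (trans (⊕-identityʳ _) (CR.zeroʳ (c zero))))

  basis-induction : ∀ {n} (P : V n → Set) → P (0v n) → (∀ u v → P u → P v → P (u +v v)) →
                    (∀ a v → P v → P (a · v)) → (∀ i → P (basis p n i)) → ∀ v → P v
  basis-induction {n} P P0 P+ P· Pbasis v =
    subst P (sym (basis-expansion v)) (P-sum (coordinates v) P-coordinate)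
    where
    P-coordinate : ∀ u → u ∈ coordinates v → P u
    P-coordinate u m with ∈-tabulate⁻ m
    ... | i , refl = P· (lookup v i) (basis p n i) (Pbasis i)
    P-sum : ∀ us → (∀ u → u ∈ us → P u) → P (sumV us)
    P-sum [] _ = P0
    P-sum (u ∷ us) Pus = P+ u (sumV us) (Pus u (here refl)) (P-sum us (λ w m → Pus w (there m)))


module Triples (p : ℕ) .{{_ : NonZero p}} (p-prime : Prime p) (n : ℕ)
  (B : Vect p (suc n) → Vect p (suc n) → 𝔽 p)
  (bilinear : IsBilinear p (suc n) B) (skew : IsSkewSymmetric p (suc n) B)
  (nondegenerate : IsNonDegenerate p (suc n) B) where

  open Counting
  open PrimeField p p-prime
  open VectorSpace p p-prime
  open import Data.Nat.Properties using (*-identityʳ)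
  open import Data.Fin using () renaming (_≟_ to _≟F_)
  open import Data.Product using (_×_; _,_; proj₁; proj₂)
  open import Data.Sum using (_⊎_; inj₁; inj₂)
  open import Data.Unit using (⊤; tt)
  open import Data.Empty using (⊥; ⊥-elim)
  open import Relation.Nullary using (¬_; Dec; yes; no)
  open import Relation.Nullary.Decidable using (¬?; _×-dec_; decidable-stable)
  open import Relation.Binary.PropositionalEquality
  open ≡-Reasoning

  d : ℕ
  d = suc n

  B-additiveˡ : ∀ u v w → B (u +v v) w ≡ B u w ⊕ B v w
  B-additiveˡ = proj₁ bilinear

  B-additiveʳ : ∀ u v w → B u (v +v w) ≡ B u v ⊕ B u w
  B-additiveʳ = proj₁ (proj₂ (proj₂ bilinear))

  B-homogeneousʳ : ∀ a u w → B u (a · w) ≡ a ⊗ B u w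
  B-homogeneousʳ = proj₂ (proj₂ (proj₂ bilinear))

  B-homogeneousˡ : ∀ a u w → B (a · u) w ≡ a ⊗ B u w
  B-homogeneousˡ = proj₁ (proj₂ bilinear)

  B-linear : ∀ y → Linear (B y)
  B-linear y = record { additive = B-additiveʳ y ; homogeneous = λ a w → B-homogeneousʳ a y w }

  ⊥-sym : ∀ u v → B u v ≡ 0F → B v u ≡ 0F
  ⊥-sym u v e = trans (skew v u) (trans (cong ⊖_ e) R.-0#≈0#)

  -- The orthogonal complement of y ≠ 0 is a hyperplane: by non-degeneracy
  -- some w has B y w ≠ 0 (found by finite search), so B y is a non-zero
  -- functional and its kernel has p^n elements.
  card-⊥ : ∀ y → y ≢ 0v d → HasCard (λ w → B y w ≡ 0F) (p ^ n)
  card-⊥ y y≢0 with search (card-V d) (λ w → ¬? (B y w ≟F 0F))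
  ... | inj₁ (w , _ , Byw≢0) = kernel-card n (B y) (B-linear y) w Byw≢0
  ... | inj₂ none = ⊥-elim (y≢0 (nondegenerate y (λ w → decidable-stable (B y w ≟F 0F) (none w tt))))

  q : V d → F
  q y = B y y

  B-lin₂ : ∀ x y a b → B y (lin₂ x y (a , b)) ≡ a ⊗ B y x ⊕ b ⊗ q y
  B-lin₂ x y a b =
    trans (B-additiveʳ y (a · x) (b · y)) (cong₂ _⊕_ (B-homogeneousʳ a y x) (B-homogeneousʳ b y y))

  GoodX : V d → V d → Set
  GoodX y x = B y x ≡ 0F × ¬ InLine y x

  GoodZ : V d → V d → V d → Set
  GoodZ y x z = B y z ≡ 0F × ¬ InPlane x y z

  Fibre : V d → V d × V d → Set
  Fibre y (x , z) = GoodX y x × GoodZ y x z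

  good⇒ : ∀ x y z → GoodTriple p d B (x , y , z) → (y ≢ 0v d) × Fibre y (x , z)
  good⇒ x y z (Bxy≡0 , Byz≡0 , indep) =
    let (y≢0 , x∉⟨y⟩ , z∉⟨x,y⟩) = independent₃⇒ indep
    in y≢0 , (⊥-sym x y Bxy≡0 , x∉⟨y⟩) , (Byz≡0 , z∉⟨x,y⟩)

  ⇒good : ∀ x y z → y ≢ 0v d → Fibre y (x , z) → GoodTriple p d B (x , y , z)
  ⇒good x y z y≢0 ((Byx≡0 , x∉⟨y⟩) , (Byz≡0 , z∉⟨x,y⟩)) =
    ⊥-sym y x Byx≡0 , Byz≡0 , ⇒independent₃ y≢0 x∉⟨y⟩ z∉⟨x,y⟩

  card-⊥∩line-isotropic : ∀ y → q y ≡ 0F → y ≢ 0v d → HasCard (λ w → B y w ≡ 0F × InLine y w) p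
  card-⊥∩line-isotropic y qy≡0 y≢0 =
    card-cong to from (card-image (_· y) (λ _ _ → ·-injective y≢0) card-F)
    where
    to : ∀ w → Image (_· y) (λ _ → ⊤) w → B y w ≡ 0F × InLine y w
    to _ (a , _ , refl) = trans (B-homogeneousʳ a y y) (trans (cong (a ⊗_) qy≡0) (CR.zeroʳ a)) , (a , refl)
    from : ∀ w → B y w ≡ 0F × InLine y w → Image (_· y) (λ _ → ⊤) w
    from _ (_ , a , w≡ay) = a , tt , w≡ay

  card-⊥∩line-anisotropic : ∀ y → q y ≢ 0F → HasCard (λ w → B y w ≡ 0F × InLine y w) 1
  card-⊥∩line-anisotropic y qy≢0 = card-cong to from (card-singleton (0v d))
    where
    to : ∀ w → w ≡ 0v d → B y w ≡ 0F × InLine y w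
    to _ refl = linear-zero (B-linear y) , (0F , sym (·-zeroˡ y))
    from : ∀ w → B y w ≡ 0F × InLine y w → w ≡ 0v d
    from _ (Byw≡0 , a , refl) = trans (cong (_· y) a≡0) (·-zeroˡ y)
      where
      a≡0 : a ≡ 0F
      a≡0 = ⊗-cancel-zero a (q y) (trans (sym (B-homogeneousʳ a y y)) Byw≡0) qy≢0

  card-⊥∩plane-isotropic : ∀ x y → q y ≡ 0F → y ≢ 0v d → GoodX y x →
                           HasCard (λ w → B y w ≡ 0F × InPlane x y w) (p * p)
  card-⊥∩plane-isotropic x y qy≡0 y≢0 (Byx≡0 , x∉⟨y⟩) =
    card-cong to from (card-image (lin₂ x y) (λ _ _ → lin₂-injective y≢0 x∉⟨y⟩)
                                  (card-Σ card-F (λ _ _ → card-F)))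
    where
    to : ∀ w → Image (lin₂ x y) (λ _ → ⊤ × ⊤) w → B y w ≡ 0F × InPlane x y w
    to _ ((a , b) , _ , refl) = (begin
      B y (lin₂ x y (a , b))      ≡⟨ B-lin₂ x y a b ⟩
      a ⊗ B y x ⊕ b ⊗ q y         ≡⟨ cong₂ (λ s t → a ⊗ s ⊕ b ⊗ t) Byx≡0 qy≡0 ⟩
      a ⊗ 0F ⊕ b ⊗ 0F             ≡⟨ cong₂ _⊕_ (CR.zeroʳ a) (CR.zeroʳ b) ⟩
      0F ⊕ 0F                     ≡⟨ ⊕-identityʳ 0F ⟩
      0F                          ∎) , ((a , b) , refl)
    from : ∀ w → B y w ≡ 0F × InPlane x y w → Image (lin₂ x y) (λ _ → ⊤ × ⊤) w
    from _ (_ , ab , w≡) = ab , (tt , tt) , w≡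

  card-⊥∩plane-anisotropic : ∀ x y → q y ≢ 0F → y ≢ 0v d → GoodX y x →
                             HasCard (λ w → B y w ≡ 0F × InPlane x y w) p
  card-⊥∩plane-anisotropic x y qy≢0 y≢0 (Byx≡0 , x∉⟨y⟩) =
    subst (HasCard _) (*-identityʳ p)
      (card-cong to from (card-image (lin₂ x y) (λ _ _ → lin₂-injective y≢0 x∉⟨y⟩)
                                     (card-Σ card-F (λ _ _ → card-singleton 0F))))
    where
    B-on-plane : ∀ a b → B y (lin₂ x y (a , b)) ≡ b ⊗ q y
    B-on-plane a b = begin
      B y (lin₂ x y (a , b))      ≡⟨ B-lin₂ x y a b ⟩
      a ⊗ B y x ⊕ b ⊗ q y         ≡⟨ cong (λ s → a ⊗ s ⊕ b ⊗ q y) Byx≡0 ⟩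
      a ⊗ 0F ⊕ b ⊗ q y            ≡⟨ cong (_⊕ b ⊗ q y) (CR.zeroʳ a) ⟩
      0F ⊕ b ⊗ q y                ≡⟨ ⊕-identityˡ _ ⟩
      b ⊗ q y                     ∎
    to : ∀ w → Image (lin₂ x y) (λ ab → ⊤ × proj₂ ab ≡ 0F) w → B y w ≡ 0F × InPlane x y w
    to _ ((a , b) , (_ , refl) , refl) = trans (B-on-plane a 0F) (CR.zeroˡ (q y)) , ((a , 0F) , refl)
    from : ∀ w → B y w ≡ 0F × InPlane x y w → Image (lin₂ x y) (λ ab → ⊤ × proj₂ ab ≡ 0F) w
    from _ (Byw≡0 , (a , b) , refl) =
      (a , b) , (tt , ⊗-cancel-zero b (q y) (trans (sym (B-on-plane a b)) Byw≡0) qy≢0) , refl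

  card-fibre : ∀ y → y ≢ 0v d → {s₁ s₂ : ℕ} →
               HasCard (λ w → B y w ≡ 0F × InLine y w) s₁ →
               (∀ x → GoodX y x → HasCard (λ w → B y w ≡ 0F × InPlane x y w) s₂) →
               HasCard (Fibre y) ((p ^ n ∸ s₁) * (p ^ n ∸ s₂))
  card-fibre y y≢0 {s₁} {s₂} card-line card-plane =
    card-Σ {Q = GoodZ y} (⊥∖ card-line (inLine? y)) (λ x gx → ⊥∖ (card-plane x gx) (inPlane? x y))
    where
    ⊥∖ : {S : V d → Set} {s : ℕ} → HasCard (λ w → B y w ≡ 0F × S w) s → (∀ w → Dec (S w)) →
         HasCard (λ w → B y w ≡ 0F × ¬ S w) (p ^ n ∸ s)
    ⊥∖ card-S S? = card-cong (λ _ (e , ¬eS) → e , λ Sw → ¬eS (e , Sw)) (λ _ (e , ¬S) → e , λ (_ , Sw) → ¬S Sw)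
      (card-∖ _≟V_ (card-⊥ y y≢0) card-S (λ _ → proj₁) (λ w → (B y w ≟F 0F) ×-dec S? w))

  q-zero : q (0v d) ≡ 0F
  q-zero = linear-zero (B-linear (0v d))

  anisotropic⇒≢0 : ∀ y → q y ≢ 0F → y ≢ 0v d
  anisotropic⇒≢0 _ qy≢0 refl = qy≢0 q-zero

  count-by-norm : ∀ {z₀ z₁} → HasCard (λ y → q y ≡ 0F × y ≢ 0v d) z₀ → HasCard (λ y → q y ≢ 0F) z₁ →
    HasCard (GoodTriple p d B) (z₀ * ((p ^ n ∸ p) * (p ^ n ∸ p * p)) + z₁ * ((p ^ n ∸ 1) * (p ^ n ∸ p)))
  count-by-norm card-iso card-aniso =
    card-cong rotate unrotate (card-image (λ (y , x , z) → x , y , z) (λ { _ _ refl → refl })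
      (card-cong merge split (card-⊎ by-iso by-aniso disjoint)))
    where
    by-iso = card-Σ {Q = Fibre} card-iso λ y (qy≡0 , y≢0) →
      card-fibre y y≢0 (card-⊥∩line-isotropic y qy≡0 y≢0)
                 (λ x gx → card-⊥∩plane-isotropic x y qy≡0 y≢0 gx)
    by-aniso = card-Σ {Q = Fibre} card-aniso λ y qy≢0 →
      card-fibre y (anisotropic⇒≢0 y qy≢0) (card-⊥∩line-anisotropic y qy≢0)
                 (λ x gx → card-⊥∩plane-anisotropic x y qy≢0 (anisotropic⇒≢0 y qy≢0) gx)
    Isotropic Anisotropic Admissible : V d × V d × V d → Set
    Isotropic (y , xz) = (q y ≡ 0F × y ≢ 0v d) × Fibre y xz
    Anisotropic (y , xz) = q y ≢ 0F × Fibre y xz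
    Admissible (y , xz) = y ≢ 0v d × Fibre y xz
    disjoint : ∀ yxz → Isotropic yxz → Anisotropic yxz → ⊥
    disjoint _ ((qy≡0 , _) , _) (qy≢0 , _) = qy≢0 qy≡0
    merge : ∀ yxz → Isotropic yxz ⊎ Anisotropic yxz → Admissible yxz
    merge (y , _) (inj₁ ((_ , y≢0) , f)) = y≢0 , f
    merge (y , _) (inj₂ (qy≢0 , f)) = anisotropic⇒≢0 y qy≢0 , f
    split : ∀ yxz → Admissible yxz → Isotropic yxz ⊎ Anisotropic yxz
    split (y , _) (y≢0 , f) with q y ≟F 0F
    ... | yes qy≡0 = inj₁ ((qy≡0 , y≢0) , f)
    ... | no qy≢0 = inj₂ (qy≢0 , f)
    rotate : ∀ xyz → Image _ Admissible xyz → GoodTriple p d B xyz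
    rotate _ ((y , x , z) , (y≢0 , f) , refl) = ⇒good x y z y≢0 f
    unrotate : ∀ xyz → GoodTriple p d B xyz → Image _ Admissible xyz
    unrotate (x , y , z) good = (y , x , z) , good⇒ x y z good , refl

  -- q is additive: the cross terms (u, v) + (v, u) cancel by skew-symmetry.
  q-additive : ∀ u v → q (u +v v) ≡ q u ⊕ q v
  q-additive u v = begin
    B (u +v v) (u +v v)                  ≡⟨ B-additiveˡ u v (u +v v) ⟩
    B u (u +v v) ⊕ B v (u +v v)          ≡⟨ cong₂ _⊕_ (B-additiveʳ u u v) (B-additiveʳ v u v) ⟩
    (q u ⊕ B u v) ⊕ (B v u ⊕ q v)        ≡⟨ cong (λ t → (q u ⊕ B u v) ⊕ (t ⊕ q v)) (skew v u) ⟩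
    (q u ⊕ B u v) ⊕ (⊖ B u v ⊕ q v)      ≡⟨ solve 3 (λ a c b → (a :+ c) :+ (:- c :+ b) := a :+ b)
                                                refl (q u) (B u v) (q v) ⟩
    q u ⊕ q v                            ∎

  q-homogeneous : ∀ a u → q (a · u) ≡ a ⊗ (a ⊗ q u)
  q-homogeneous a u = trans (B-homogeneousˡ a u (a · u)) (cong (a ⊗_) (B-homogeneousʳ a u u))

  q-vanishes : (∀ i → q (basis p d i) ≡ 0F) → ∀ y → q y ≡ 0F
  q-vanishes q-basis = basis-induction (λ y → q y ≡ 0F) q-zero
    (λ u v qu≡0 qv≡0 → trans (q-additive u v) (trans (cong₂ _⊕_ qu≡0 qv≡0) (⊕-identityʳ 0F)))
    (λ a u qu≡0 → trans (q-homogeneous a u) (trans (cong (λ t → a ⊗ (a ⊗ t)) qu≡0)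
                                                  (trans (cong (a ⊗_) (CR.zeroʳ a)) (CR.zeroʳ a))))
    q-basis

  -- A vector of norm 1 forces characteristic 2, since q e = -q e.
  norm-one⇒p≡2 : ∀ e → q e ≡ 1F → p ≡ 2
  norm-one⇒p≡2 e qe≡1 = 1≡-1⇒p≡2 (trans (sym qe≡1) (trans (skew e e) (cong ⊖_ qe≡1)))

  -- In characteristic 2, a² = a makes q a linear functional.
  q-linear : p ≡ 2 → Linear q
  q-linear p≡2 = record
    { additive = q-additive
    ; homogeneous = λ a u → trans (q-homogeneous a u)
                                  (trans (sym (⊗-assoc a a (q u))) (cong (_⊗ q u) (p≡2⇒⊗-idem p≡2 a)))
    }

  count-isotropic : (∀ y → q y ≡ 0F) →
    HasCard (GoodTriple p d B) ((p ^ d ∸ 1) * ((p ^ n ∸ p) * (p ^ n ∸ p * p)) + 0 * ((p ^ n ∸ 1) * (p ^ n ∸ p)))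
  count-isotropic q≡0 = count-by-norm
    (card-cong (λ y (_ , y≢0) → q≡0 y , y≢0) (λ _ (_ , y≢0) → tt , y≢0)
      (card-∖ _≟V_ (card-V d) (card-singleton (0v d)) (λ _ _ → tt) (λ y → y ≟V 0v d)))
    (card-empty (λ y qy≢0 → qy≢0 (q≡0 y)))

  -- Part (2): in characteristic 2 with q e = 1, q is a non-zero functional,
  -- so p^n vectors are isotropic and p^d - p^n are not.
  count-char-2 : p ≡ 2 → ∀ e → q e ≡ 1F →
    HasCard (GoodTriple p d B)
      ((p ^ n ∸ 1) * ((p ^ n ∸ p) * (p ^ n ∸ p * p)) + (p ^ d ∸ p ^ n) * ((p ^ n ∸ 1) * (p ^ n ∸ p)))
  count-char-2 p≡2 e qe≡1 = count-by-norm
    (card-∖ _≟V_ card-ker-q (card-singleton (0v d)) (λ { _ refl → q-zero }) (λ y → y ≟V 0v d))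
    (card-cong (λ _ → proj₂) (λ _ qy≢0 → tt , qy≢0)
      (card-∖ _≟V_ (card-V d) card-ker-q (λ _ _ → tt) (λ y → q y ≟F 0F)))
    where
    card-ker-q : HasCard (λ y → q y ≡ 0F) (p ^ n)
    card-ker-q = kernel-card n q (q-linear p≡2) e (λ qe≡0 → 1≢0 (trans (sym qe≡1) qe≡0))


isotropic-closed-form : ∀ a b c k z → a * (b * (c ∸ k * k)) + 0 * z ≡ a * b * (c ∸ k ^ 2)
isotropic-closed-form a b c k z = trans (+-identityʳ _)
  (trans (cong (λ t → a * (b * (c ∸ k * t))) (sym (*-identityʳ k))) (sym (*-assoc a b _)))

-- The closed form in part (2), with A = 2^(d-1) ≥ 4 written as 4 + t.
char-2-closed-form : ∀ A → 4 ≤ A →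
  (A ∸ 1) * ((A ∸ 2) * (A ∸ 2 * 2)) + (2 * A ∸ A) * ((A ∸ 1) * (A ∸ 2))
    ≡ (A ∸ 1) * (A ∸ 2) * (2 * A ∸ 4)
char-2-closed-form A 4≤A with m≤n⇒∃[o]m+o≡n 4≤A
... | t , refl rewrite m+n∸m≡n (4 + t) ((4 + t) + 0) =
  solve 1 (λ t → (con 3 :+ t) :* ((con 2 :+ t) :* t) :+ ((con 4 :+ t) :+ con 0) :* ((con 3 :+ t) :* (con 2 :+ t))
             := (con 3 :+ t) :* (con 2 :+ t) :* (t :+ ((con 4 :+ t) :+ con 0))) refl t
  where open +-*-Solver

lemma3p6 : (p : ℕ) .{{_ : NonZero p}} → Prime p →
    (d : ℕ) → 3 ≤ d →
    (B : Vect p d → Vect p d → 𝔽 p) →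
    IsBilinear p d B → IsSkewSymmetric p d B → IsNonDegenerate p d B →
    (N : ℕ) → HasCard (GoodTriple p d B) N →
    ((∀ (i : Fin d) → B (basis p d i) (basis p d i) ≡ 0𝔽 p) →
      N ≡ (p ^ d ∸ 1) * (p ^ (d ∸ 1) ∸ p) * (p ^ (d ∸ 1) ∸ p ^ 2))
    ×
    ((∀ (i : Fin d) → toℕ i ≡ 0 → B (basis p d i) (basis p d i) ≡ 1𝔽 p) →
     (∀ (i : Fin d) → toℕ i ≢ 0 → B (basis p d i) (basis p d i) ≡ 0𝔽 p) →
      (p ≡ 2) × (N ≡ (2 ^ (d ∸ 1) ∸ 1) * (2 ^ (d ∸ 1) ∸ 2) * (2 ^ d ∸ 4)))
lemma3p6 p p-prime (suc n@(suc (suc _))) (s≤s (s≤s (s≤s z≤n))) B bilinear skew nondegenerate N card-N =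
  part1 , part2
  where
  open Triples p p-prime n B bilinear skew nondegenerate
  open VectorSpace p p-prime using (_≟V_)
  open Counting using (card-unique)

  N≡ : ∀ {c} → HasCard (GoodTriple p (suc n) B) c → N ≡ c
  N≡ = card-unique (≡-dec _≟V_ (≡-dec _≟V_ _≟V_)) card-N

  e₀ : Vect p d
  e₀ = basis p d zero

  part1 : (∀ i → q (basis p d i) ≡ 0𝔽 p) → N ≡ (p ^ d ∸ 1) * (p ^ n ∸ p) * (p ^ n ∸ p ^ 2)
  part1 q-basis = trans (N≡ (count-isotropic (q-vanishes q-basis)))
                        (isotropic-closed-form (p ^ d ∸ 1) (p ^ n ∸ p) (p ^ n) p ((p ^ n ∸ 1) * (p ^ n ∸ p)))

  part2 : (∀ (i : Fin d) → toℕ i ≡ 0 → q (basis p d i) ≡ 1𝔽 p) →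
          (∀ (i : Fin d) → toℕ i ≢ 0 → q (basis p d i) ≡ 0𝔽 p) →
          (p ≡ 2) × (N ≡ (2 ^ n ∸ 1) * (2 ^ n ∸ 2) * (2 ^ d ∸ 4))
  part2 q-e₀≡1 _ = p≡2 , trans (subst (λ r → N ≡ count r) p≡2 (N≡ (count-char-2 p≡2 e₀ q-e₀)))
                               (char-2-closed-form (2 ^ n) (^-monoʳ-≤ 2 {2} {n} (s≤s (s≤s z≤n))))
    where
    q-e₀ : q e₀ ≡ 1𝔽 p
    q-e₀ = q-e₀≡1 zero refl
    p≡2 : p ≡ 2
    p≡2 = norm-one⇒p≡2 e₀ q-e₀
    count : ℕ → ℕ
    count r = (r ^ n ∸ 1) * ((r ^ n ∸ r) * (r ^ n ∸ r * r)) + (r ^ d ∸ r ^ n) * ((r ^ n ∸ 1) * (r ^ n ∸ r))
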